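{- Let $p>3$ be a prime number. Then the number of unrefinable partitions $\lambda$ into distinct parts whose largest part equals $p$ and whose number of missing parts equals $\left\lfloor \frac{p}{2}\right\rfloor$ is equal to the number of symmetric numerical semigroups $S$ with Frobenius number $F(S)=p$. In symbols, \[ \#\bar{\mathcal{U}}(p)=\#\{S \text{ symmetric numerical semigroup} \mid F(S)=p\}. \]
   Context: A partition into distinct parts is a sequence $\lambda=(\lambda_1,\ldots,\lambda_t)$ of positive integers with $\lambda_1<\lambda_2<\cdots<\lambda_t$ and $t\ge 2$. Its set of missing parts is $\mathcal{M}_\lambda=\{1,2,\ldots,\lambda_t\}\setminus\{\lambda_1,\ldots,\lambda_t\}$. The partition is refinable if some part $\lambda_\ell$ equals a sum $\mu_{i_1}+\cdots+\mu_{i_k}$ of $k\ge 2$ pairwise distinct missing parts; otherwise it is unrefinable. For a positive integer $n$, $\bar{\mathcal{U}}(n)$ denotes the set of unrefinable partitions $\lambda$ with largest part $\lambda_t=n$ and $\#\mathcal{M}_\lambda=\lfloor n/2\rfloor$. A numerical semigroup is a subset $S\subseteq\mathbb{N}_0$ containing $0$, closed under addition, with $\mathbb{N}_0\setminus S$ finite; its Frobenius number $F(S)$ is the largest element of $\mathbb{N}_0\setminus S$. A numerical semigroup $S$ is symmetric if $F(S)$ is odd and for every $x\in\mathbb{N}_0\setminus S$ one has $F(S)-x\in S$. -}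

module Defs where

open import Data.Nat using (ℕ; _+_; _≤_; _<_; _∸_)
open import Data.Nat.Properties using (_≟_)
open import Data.Nat.DivMod using (_/_; _%_)
open import Data.Bool using (Bool; true; false)
open import Data.Maybe using (just)
open import Data.List using (List; length; filter; applyUpTo; last)
open import Data.Nat.ListAction using (sum)
open import Data.List.Membership.Propositional using (_∈_; _∉_)
open import Data.List.Membership.DecPropositional _≟_ using (_∈?_)
open import Data.List.Relation.Unary.All using (All)
open import Data.List.Relation.Unary.Any using (Any)
open import Data.List.Relation.Unary.Linked using (Linked)
open import Data.List.Relation.Unary.AllPairs using (AllPairs)
open import Data.List.Relation.Unary.Unique.Propositional using (Unique)
open import Data.Product using (Σ; ∃; ∃-syntax; _×_)
open import Relation.Binary.PropositionalEquality using (_≡_)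
open import Relation.Nullary using (¬_; ¬?)
open import Function.Bundles using (_⇔_)

record IsDistinctPartition (λs : List ℕ) : Set where
  field
    increasing : Linked _<_ λs
    positive   : All (λ x → 1 ≤ x) λs
    twoParts   : 2 ≤ length λs

LargestPart : List ℕ → ℕ → Set
LargestPart λs n = last λs ≡ just n

missingParts : ℕ → List ℕ → List ℕ
missingParts n λs = filter (λ μ → ¬? (μ ∈? λs)) (applyUpTo (λ i → i + 1) n)

Refinable : ℕ → List ℕ → Set
Refinable n λs =
  Σ ℕ λ ℓ → ℓ ∈ λs × (Σ (List ℕ) λ μs →
    Unique μs × 2 ≤ length μs × All (λ μ → μ ∈ missingParts n λs) μs × sum μs ≡ ℓ)

InUbar : ℕ → List ℕ → Set
InUbar n λs =
  IsDistinctPartition λs × LargestPart λs n × ¬ Refinable n λs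
  × length (missingParts n λs) ≡ n / 2

Subset : Set
Subset = ℕ → Bool

record IsNumericalSemigroup (S : Subset) : Set where
  field
    zero∈    : S 0 ≡ true
    closed   : ∀ a b → S a ≡ true → S b ≡ true → S (a + b) ≡ true
    cofinite : ∃[ N ] (∀ x → N ≤ x → S x ≡ true)

HasFrobenius : Subset → ℕ → Set
HasFrobenius S F = S F ≡ false × (∀ x → F < x → S x ≡ true)

SymmetricWithFrobenius : ℕ → Subset → Set
SymmetricWithFrobenius F S =
  IsNumericalSemigroup S × HasFrobenius S F × F % 2 ≡ 1
  × (∀ x → S x ≡ false → S (F ∸ x) ≡ true)

HasCount : (List ℕ → Set) → ℕ → Set
HasCount P k =
  Σ (List (List ℕ)) λ xs → length xs ≡ k × Unique xs × (∀ ys → (ys ∈ xs) ⇔ P ys)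

_≐_ : Subset → Subset → Set
S ≐ T = ∀ x → S x ≡ T x

HasCountSubsets : (Subset → Set) → ℕ → Set
HasCountSubsets P k =
  Σ (List Subset) λ Ss → length Ss ≡ k × AllPairs (λ S T → ¬ (S ≐ T)) Ss
    × (∀ S → Any (S ≐_) Ss ⇔ P S)

-- An unrefinable partition λ ∈ Ū(p) and the set of gaps of a symmetric numerical
-- semigroup with Frobenius number p are the same object, a symmetric gap set: a set
-- G ⊆ {1,…,p} with p ∈ G, whose complement is closed under sums ≤ p, and which
-- contains exactly one of x and p − x for 0 < x < p.  For a partition with largest
-- part p: if x and p − x were both missing they would refine p (they differ since p
-- is odd), so each of the ⌊p/2⌋ pairs contains at most one missing part, hence
-- exactly one.  Two distinct missing parts summing to a part refine it; and if a is
-- missing while 2a is a part, then p − 2a is missing, differs from a because 3 ∤ p,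
-- and a + (p − 2a) = p − a is a part.  Conversely, sums of non-gaps are non-gaps, so
-- no part is a sum of missing parts.  Both sides are therefore counted by one list:
-- the sublists of [1..p] that are symmetric gap sets.

module Submission where

open import Defs
open import Data.Nat using (ℕ; _<_)
open import Data.Nat.Primality using (Prime)
open import Data.Product using (∃-syntax; _×_)

open import Algebra.Properties.CommutativeSemigroup using (interchange)
open import Data.Bool using (true; false; not)
import Data.Bool.Properties as Bool
open import Data.List using (List; []; _∷_; _++_; [_]; map; filter; applyUpTo; length; last)
open import Data.List.Membership.DecPropositional Data.Nat._≟_ using (_∈?_)
open import Data.List.Membership.Propositional using (_∈_; _∉_; find; lose)
open import Data.List.Membership.Propositional.Properties
  using (∈-++⁺ˡ; ∈-++⁺ʳ; ∈-++⁻; ∈-map⁺; ∈-map⁻; ∈-filter⁺; ∈-filter⁻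
        ; ∈-applyUpTo⁺; ∈-applyUpTo⁻)
open import Data.List.Properties using (∷-injectiveʳ; length-map)
open import Data.List.Relation.Binary.Sublist.Propositional
  using (_⊆_; []; _∷_; _∷ʳ_; minimum; lookup; ⊆-antisym)
open import Data.List.Relation.Binary.Sublist.Propositional.Properties using (All-resp-⊆; filter-⊆)
open import Data.List.Relation.Unary.All as All using (All; []; _∷_)
import Data.List.Relation.Unary.All.Properties as All
open import Data.List.Relation.Unary.AllPairs as AllPairs using (AllPairs; []; _∷_)
import Data.List.Relation.Unary.AllPairs.Properties as AllPairs
open import Data.List.Relation.Unary.Any using (Any; here; there)
import Data.List.Relation.Unary.Any.Properties as Any
import Data.List.Relation.Unary.Linked.Properties as Linked
open import Data.List.Relation.Unary.Unique.Propositional using (Unique)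
import Data.List.Relation.Unary.Unique.Propositional.Properties as Unique
open import Data.Maybe using (just)
open import Data.Nat using (zero; suc; _+_; _*_; _∸_; _≤_; _≤?_; _≟_; s≤s; z≤n; z<s; s<s)
open import Data.Nat.DivMod using (_/_; _%_; m/n≡1+[m∸n]/n; [m+kn]%n≡m%n)
open import Data.Nat.Divisibility using (_∤_; divides)
open import Data.Nat.ListAction using (sum)
open import Data.Nat.Primality using (prime⇒irreducible)
open import Data.Nat.Properties
open import Data.Nat.Tactic.RingSolver using (solve-∀)
open import Data.Product using (_,_; proj₁; proj₂; uncurry)
open import Data.Sum using (_⊎_; inj₁; inj₂)
open import Function using (_∘_)
open import Function.Bundles using (mk⇔)
open import Relation.Binary.PropositionalEquality
  using (_≡_; _≢_; refl; sym; trans; cong; cong₂; subst; module ≡-Reasoning)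
open import Relation.Nullary using (¬_; Dec; yes; no; does; ¬?; contradiction; _×-dec_; _→-dec_)
open import Relation.Nullary.Decidable using (map′)

private
  variable
    A : Set
    n x y : ℕ
    xs ys G H : List ℕ
    f g : ℕ → ℕ
    S T : Subset

sublists : List A → List (List A)
sublists []       = [ [] ]
sublists (x ∷ xs) = map (x ∷_) (sublists xs) ++ sublists xs

∈-sublists⁺ : {xs ys : List A} → ys ⊆ xs → ys ∈ sublists xs
∈-sublists⁺ []         = here refl
∈-sublists⁺ (x ∷ʳ τ)   = ∈-++⁺ʳ _ (∈-sublists⁺ τ)
∈-sublists⁺ (refl ∷ τ) = ∈-++⁺ˡ (∈-map⁺ _ (∈-sublists⁺ τ))

∈-sublists⁻ : (xs : List A) {ys : List A} → ys ∈ sublists xs → ys ⊆ xs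
∈-sublists⁻ []       (here refl) = []
∈-sublists⁻ (x ∷ xs) ys∈ with ∈-++⁻ (map (x ∷_) (sublists xs)) ys∈
... | inj₂ ys∈′ = x ∷ʳ ∈-sublists⁻ xs ys∈′
... | inj₁ ys∈′ with ∈-map⁻ (x ∷_) ys∈′
...   | _ , zs∈ , refl = refl ∷ ∈-sublists⁻ xs zs∈

sublists-unique : {xs : List A} → Unique xs → Unique (sublists xs)
sublists-unique []                         = [] ∷ []
sublists-unique {xs = x ∷ xs} (x∉xs ∷ u) =
  Unique.++⁺ (Unique.map⁺ ∷-injectiveʳ (sublists-unique u)) (sublists-unique u) disjoint
  where
  disjoint : ∀ {zs} → ¬ (zs ∈ map (x ∷_) (sublists xs) × zs ∈ sublists xs)
  disjoint (zs∈ , zs∈′) with ∈-map⁻ (x ∷_) zs∈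
  ... | _ , _ , refl = All.lookup x∉xs (lookup (∈-sublists⁻ xs zs∈′) (here refl)) refl

AllPairs-resp-⊆ : ∀ {R : A → A → Set} {xs ys : List A} → ys ⊆ xs → AllPairs R xs → AllPairs R ys
AllPairs-resp-⊆ []         []         = []
AllPairs-resp-⊆ (_ ∷ʳ τ)   (_ ∷ rxs)  = AllPairs-resp-⊆ τ rxs
AllPairs-resp-⊆ (refl ∷ τ) (rx ∷ rxs) = All-resp-⊆ τ rx ∷ AllPairs-resp-⊆ τ rxs

StrictlyIncreasing : List ℕ → Set
StrictlyIncreasing = AllPairs _<_

∈-tail : x ∈ y ∷ ys → y < x → x ∈ ys
∈-tail (here refl)  y<x = contradiction y<x (<-irrefl refl)
∈-tail (there x∈ys) _   = x∈ys

increasing-⊆ : StrictlyIncreasing ys → StrictlyIncreasing xs →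
  (∀ {z} → z ∈ ys → z ∈ xs) → ys ⊆ xs
increasing-⊆ {[]}     _ _ _ = minimum _
increasing-⊆ {y ∷ ys} {[]} _ _ sub with () ← sub (here refl)
increasing-⊆ {y ∷ ys} {x ∷ xs} (y< ∷ iys) (x< ∷ ixs) sub with sub (here refl)
... | here refl  =
  refl ∷ increasing-⊆ iys ixs (λ z∈ys → ∈-tail (sub (there z∈ys)) (All.lookup y< z∈ys))
... | there y∈xs =
  x ∷ʳ increasing-⊆ (y< ∷ iys) ixs (λ z∈ → ∈-tail (sub z∈) (x<z z∈))
  where
  x<z : ∀ {z} → z ∈ y ∷ ys → x < z
  x<z (here refl)  = All.lookup x< y∈xs
  x<z (there z∈ys) = <-trans (All.lookup x< y∈xs) (All.lookup y< z∈ys)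

increasing-≡ : StrictlyIncreasing xs → StrictlyIncreasing ys →
  (∀ {z} → z ∈ xs → z ∈ ys) → (∀ {z} → z ∈ ys → z ∈ xs) → xs ≡ ys
increasing-≡ ixs iys xs⊆ys ys⊆xs =
  ⊆-antisym (increasing-⊆ ixs iys xs⊆ys) (increasing-⊆ iys ixs ys⊆xs)

last-∈ : last xs ≡ just n → n ∈ xs
last-∈ {x ∷ []}     refl = here refl
last-∈ {x ∷ y ∷ xs} eq   = there (last-∈ {y ∷ xs} eq)

last-maximum : StrictlyIncreasing xs → last xs ≡ just n → All (_≤ n) xs
last-maximum {x ∷ []}     _          refl = ≤-refl ∷ []
last-maximum {x ∷ y ∷ xs} (x< ∷ inc) eq   = <⇒≤ (All.lookup x< (last-∈ eq)) ∷ last-maximum inc eq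

maximum-last : StrictlyIncreasing xs → All (_≤ n) xs → n ∈ xs → last xs ≡ just n
maximum-last {x ∷ []}     _         _             (here refl) = refl
maximum-last {x ∷ y ∷ xs} (x< ∷ _)  (_ ∷ y≤x ∷ _) (here refl) =
  contradiction (All.head x<) (≤⇒≯ y≤x)
maximum-last {x ∷ y ∷ xs} (_ ∷ inc) (_ ∷ ≤n)      (there n∈)  = maximum-last inc ≤n n∈

∈-∈-≢⇒2≤length : x ∈ xs → y ∈ xs → x ≢ y → 2 ≤ length xs
∈-∈-≢⇒2≤length {xs = _ ∷ []}    (here refl) (here refl) x≢y = contradiction refl x≢y
∈-∈-≢⇒2≤length {xs = _ ∷ _ ∷ _} _           _           _   = s≤s (s≤s z≤n)

-- {1,…,n} in the form used by Defs.missingParts, which is a filter of it.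
oneTo : ℕ → List ℕ
oneTo n = applyUpTo (λ i → i + 1) n

∈-oneTo⁺ : 0 < x → x ≤ n → x ∈ oneTo n
∈-oneTo⁺ {suc k} {n} _ k<n = subst (_∈ oneTo n) (+-comm k 1) (∈-applyUpTo⁺ (λ i → i + 1) k<n)

∈-oneTo⁻ : x ∈ oneTo n → 0 < x × x ≤ n
∈-oneTo⁻ {n = n} x∈ with ∈-applyUpTo⁻ (λ i → i + 1) x∈
... | i , i<n , refl = subst (0 <_) (+-comm 1 i) z<s , subst (_≤ n) (+-comm 1 i) i<n

oneTo-increasing : ∀ n → StrictlyIncreasing (oneTo n)
oneTo-increasing n = AllPairs.applyUpTo⁺₁ _ n (λ i<j _ → +-monoˡ-< 1 i<j)

sumBelow : ℕ → (ℕ → ℕ) → ℕ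
sumBelow zero    f = 0
sumBelow (suc n) f = f 0 + sumBelow n (f ∘ suc)

sumBelow-cong : (∀ {i} → i < n → f i ≡ g i) → sumBelow n f ≡ sumBelow n g
sumBelow-cong {zero}  _   = refl
sumBelow-cong {suc n} f≗g = cong₂ _+_ (f≗g z<s) (sumBelow-cong (f≗g ∘ s<s))

sumBelow-suc : ∀ n f → sumBelow (suc n) f ≡ sumBelow n f + f n
sumBelow-suc zero    f = +-comm (f 0) 0
sumBelow-suc (suc n) f = trans (cong (f 0 +_) (sumBelow-suc n (f ∘ suc))) (sym (+-assoc (f 0) _ _))

sumBelow-+ : ∀ n f g → sumBelow n (λ i → f i + g i) ≡ sumBelow n f + sumBelow n g
sumBelow-+ zero    f g = refl
sumBelow-+ (suc n) f g = trans (cong (f 0 + g 0 +_) (sumBelow-+ n (f ∘ suc) (g ∘ suc)))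
                               (interchange +-commutativeSemigroup (f 0) (g 0) _ _)

sumBelow-reverse : ∀ n (f : ℕ → ℕ) → sumBelow n (f ∘ suc) ≡ sumBelow n (λ i → f (n ∸ i))
sumBelow-reverse zero    f = refl
sumBelow-reverse (suc n) f = begin
  sumBelow (suc n) (f ∘ suc)                ≡⟨ sumBelow-suc n (f ∘ suc) ⟩
  sumBelow n (f ∘ suc) + f (suc n)          ≡⟨ cong (_+ f (suc n)) (sumBelow-reverse n f) ⟩
  sumBelow n (λ i → f (n ∸ i)) + f (suc n)  ≡⟨ +-comm (sumBelow n (λ i → f (n ∸ i))) (f (suc n)) ⟩
  sumBelow (suc n) (λ i → f (suc n ∸ i))    ∎
  where open ≡-Reasoning

sumBelow-ones : (∀ {i} → i < n → f i ≡ 1) → sumBelow n f ≡ n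
sumBelow-ones {zero}  _    = refl
sumBelow-ones {suc n} ones = cong₂ _+_ (ones z<s) (sumBelow-ones (ones ∘ s<s))

sumBelow-≤ : (∀ {i} → i < n → f i ≤ 1) → sumBelow n f ≤ n
sumBelow-≤ {zero}  _  = z≤n
sumBelow-≤ {suc n} ≤1 = +-mono-≤ (≤1 z<s) (sumBelow-≤ (≤1 ∘ s<s))

sumBelow≡n⇒ones : (∀ {i} → i < n → f i ≤ 1) → sumBelow n f ≡ n → ∀ {i} → i < n → f i ≡ 1
sumBelow≡n⇒ones {suc n} {f} ≤1 eq {zero}  _         =
  ≤-antisym (≤1 z<s)
    (+-cancelʳ-≤ n 1 (f 0) (subst (_≤ f 0 + n) eq (+-monoʳ-≤ (f 0) (sumBelow-≤ (≤1 ∘ s<s)))))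
sumBelow≡n⇒ones {suc n} {f} ≤1 eq {suc i} (s<s i<n) =
  sumBelow≡n⇒ones (≤1 ∘ s<s) (suc-injective (trans (cong (_+ sumBelow n (f ∘ suc)) (sym f0≡1)) eq)) i<n
  where
  f0≡1 : f 0 ≡ 1
  f0≡1 = sumBelow≡n⇒ones ≤1 eq z<s

x+x≡x*2 : ∀ x → x + x ≡ x * 2
x+x≡x*2 = solve-∀

x+x+x≡x*3 : ∀ x → x + x + x ≡ x * 3
x+x+x≡x*3 = solve-∀

x+x≢1+m+m : ∀ x m → x + x ≢ suc (m + m)
x+x≢1+m+m x m eq =
  even≢odd x m (trans (cong (x +_) (+-identityʳ x))
                      (trans eq (cong (λ k → suc (m + k)) (sym (+-identityʳ m)))))

1+m+m/2≡m : ∀ m → suc (m + m) / 2 ≡ m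
1+m+m/2≡m zero    = refl
1+m+m/2≡m (suc m) = trans (m/n≡1+[m∸n]/n {suc (suc m + suc m)} {2} (s≤s (s≤s z≤n)))
                          (cong suc (trans (cong (_/ 2) (+-suc m m)) (1+m+m/2≡m m)))

1+m+m%2≡1 : ∀ m → suc (m + m) % 2 ≡ 1
1+m+m%2≡1 m = trans (cong (λ k → suc k % 2) (x+x≡x*2 m)) ([m+kn]%n≡m%n 1 m 2)

even⊎odd : ∀ n → (∃[ m ] n ≡ m + m) ⊎ (∃[ m ] n ≡ suc (m + m))
even⊎odd zero    = inj₁ (0 , refl)
even⊎odd (suc n) with even⊎odd n
... | inj₁ (m , refl) = inj₂ (m , refl)
... | inj₂ (m , refl) = inj₁ (suc m , cong suc (sym (+-suc m m)))

prime-odd : ∀ {p} → Prime p → 2 < p → ∃[ m ] p ≡ suc (m + m)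
prime-odd {p} p-prime 2<p with even⊎odd p
... | inj₂ odd         = odd
... | inj₁ (m , p≡m+m) with prime⇒irreducible p-prime (divides m (trans p≡m+m (x+x≡x*2 m)))
...   | inj₁ ()
...   | inj₂ 2≡p = contradiction 2≡p (<⇒≢ 2<p)

-- Symmetric gap sets

-- Only one half of “exactly one of x and p − x” is a field; complement∈ derives the other.
record IsSymmetricGapSet (p : ℕ) (G : List ℕ) : Set where
  field
    frobenius∈ : p ∈ G
    sum∉       : ∀ a b → a ∉ G → b ∉ G → a + b ≤ p → a + b ∉ G
    symmetric  : ∀ {x} → x ∈ G → p ∸ x ∉ G

  0∉ : 0 ∉ G
  0∉ 0∈ = symmetric 0∈ frobenius∈

  complement∈ : x ≤ p → x ∉ G → p ∸ x ∈ G
  complement∈ {x} x≤p x∉ with (p ∸ x) ∈? G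
  ... | yes p∸x∈ = p∸x∈
  ... | no  p∸x∉ = contradiction (subst (_∈ G) (sym x+[p∸x]≡p) frobenius∈)
                                 (sum∉ x (p ∸ x) x∉ p∸x∉ (≤-reflexive x+[p∸x]≡p))
    where x+[p∸x]≡p = m+[n∸m]≡n x≤p

  sum-∉ : ∀ {μs} → All (_∉ G) μs → sum μs ≤ p → sum μs ∉ G
  sum-∉ []                   _     = 0∉
  sum-∉ {μ ∷ μs} (μ∉ ∷ μs∉) Σμs≤p =
    sum∉ μ (sum μs) μ∉ (sum-∉ μs∉ (≤-trans (m≤n+m (sum μs) μ) Σμs≤p)) Σμs≤p

isSymmetricGapSet? : ∀ p G → Dec (IsSymmetricGapSet p G)
isSymmetricGapSet? p G =
  map′ toRecord fromRecord (p ∈? G ×-dec boundedSum∉? ×-dec All.all? (λ x → ¬? (p ∸ x ∈? G)) G)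
  where
  BoundedSum∉ : Set
  BoundedSum∉ =
    ∀ {a} → a < suc p → ∀ {b} → b < suc p → a ∉ G → b ∉ G → a + b ≤ p → a + b ∉ G
  boundedSum∉? : Dec BoundedSum∉
  boundedSum∉? = allUpTo? (λ a → allUpTo? (λ b →
    ¬? (a ∈? G) →-dec ¬? (b ∈? G) →-dec a + b ≤? p →-dec ¬? (a + b ∈? G)) (suc p)) (suc p)
  toRecord : p ∈ G × BoundedSum∉ × All (λ x → p ∸ x ∉ G) G → IsSymmetricGapSet p G
  toRecord (p∈ , sum∉ , p∸x∉) = record
    { frobenius∈ = p∈
    ; sum∉       = λ a b a∉ b∉ a+b≤p →
        sum∉ (s≤s (m+n≤o⇒m≤o a a+b≤p)) (s≤s (m+n≤o⇒n≤o a a+b≤p)) a∉ b∉ a+b≤p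
    ; symmetric  = All.lookup p∸x∉
    }
  fromRecord : IsSymmetricGapSet p G → p ∈ G × BoundedSum∉ × All (λ x → p ∸ x ∉ G) G
  fromRecord gs = frobenius∈ , (λ {a} _ {b} _ → sum∉ a b) , All.tabulate symmetric
    where open IsSymmetricGapSet gs

gapSets : ℕ → List (List ℕ)
gapSets p = filter (isSymmetricGapSet? p) (sublists (oneTo p))

∈-gapSets⁺ : ∀ {p} → G ⊆ oneTo p → IsSymmetricGapSet p G → G ∈ gapSets p
∈-gapSets⁺ {p = p} G⊆ gs = ∈-filter⁺ (isSymmetricGapSet? p) (∈-sublists⁺ G⊆) gs

∈-gapSets⁻ : ∀ {p} → G ∈ gapSets p → G ⊆ oneTo p × IsSymmetricGapSet p G
∈-gapSets⁻ {p = p} G∈ with ∈-filter⁻ (isSymmetricGapSet? p) {xs = sublists (oneTo p)} G∈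
... | G∈sublists , gs = ∈-sublists⁻ (oneTo p) G∈sublists , gs

gapSets-unique : ∀ p → Unique (gapSets p)
gapSets-unique p =
  Unique.filter⁺ (isSymmetricGapSet? p) (sublists-unique (AllPairs.map <⇒≢ (oneTo-increasing p)))

gapSets-increasing : ∀ p → All StrictlyIncreasing (gapSets p)
gapSets-increasing p =
  All.tabulate λ G∈ → AllPairs-resp-⊆ (proj₁ (∈-gapSets⁻ G∈)) (oneTo-increasing p)

-- Unrefinable partitions and symmetric gap sets

missing : List ℕ → ℕ → ℕ
missing ys x with x ∈? ys
... | yes _ = 0
... | no  _ = 1

missing-∈ : x ∈ ys → missing ys x ≡ 0
missing-∈ {x} {ys} x∈ with x ∈? ys
... | yes _  = refl
... | no x∉ = contradiction x∈ x∉

missing+missing≤1 : ¬ (x ∉ ys × y ∉ ys) → missing ys x + missing ys y ≤ 1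
missing+missing≤1 {x} {ys} {y} notBoth with x ∈? ys | y ∈? ys
... | yes _ | yes _ = z≤n
... | yes _ | no  _ = ≤-refl
... | no  _ | yes _ = ≤-refl
... | no x∉ | no y∉ = contradiction (x∉ , y∉) notBoth

missing+missing≡1 : (x ∈ ys → y ∉ ys) → (x ∉ ys → y ∈ ys) → missing ys x + missing ys y ≡ 1
missing+missing≡1 {x} {ys} {y} x∈⇒y∉ x∉⇒y∈ with x ∈? ys | y ∈? ys
... | yes x∈ | yes y∈ = contradiction y∈ (x∈⇒y∉ x∈)
... | yes _  | no  _  = refl
... | no  _  | yes _  = refl
... | no x∉  | no y∉  = contradiction (x∉⇒y∈ x∉) y∉

missing+missing≡1⇒ : missing ys x + missing ys y ≡ 1 → x ∈ ys → y ∉ ys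
missing+missing≡1⇒ {ys} {x} {y} eq x∈ with x ∈? ys | y ∈? ys
... | yes _ | yes _  = contradiction eq λ ()
... | yes _ | no y∉ = y∉
... | no x∉ | _      = contradiction x∈ x∉

length-missingParts : ∀ n ys → length (missingParts n ys) ≡ sumBelow n (missing ys ∘ suc)
length-missingParts n ys =
  trans (length-filter n (λ i → i + 1)) (sumBelow-cong {n} (λ {i} _ → cong (missing ys) (+-comm i 1)))
  where
  length-filter : ∀ n (f : ℕ → ℕ) →
    length (filter (λ μ → ¬? (μ ∈? ys)) (applyUpTo f n)) ≡ sumBelow n (missing ys ∘ f)
  length-filter zero    f = refl
  length-filter (suc n) f with f 0 ∈? ys
  ... | yes _ = length-filter n (f ∘ suc)
  ... | no  _ = cong suc (length-filter n (f ∘ suc))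

-- Pairing x with p − x; the sum on the right has one term for each 0 < x < p = 1 + n.
missingParts-double : ∀ n ys → suc n ∈ ys →
  let M = length (missingParts (suc n) ys) in
  M + M ≡ sumBelow n (λ i → missing ys (suc i) + missing ys (suc n ∸ suc i))
missingParts-double n ys 1+n∈ = begin
  M + M
    ≡⟨ cong₂ _+_ M≡ (trans M≡ (sumBelow-reverse n (missing ys))) ⟩
  sumBelow n (missing ys ∘ suc) + sumBelow n (λ i → missing ys (n ∸ i))
    ≡⟨ sym (sumBelow-+ n _ _) ⟩
  sumBelow n (λ i → missing ys (suc i) + missing ys (n ∸ i))
    ∎
  where
  open ≡-Reasoning
  M = length (missingParts (suc n) ys)
  h = missing ys ∘ suc
  M≡ : M ≡ sumBelow n h
  M≡ = begin
    M                       ≡⟨ length-missingParts (suc n) ys ⟩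
    sumBelow (suc n) h      ≡⟨ sumBelow-suc n h ⟩
    sumBelow n h + h n      ≡⟨ cong (sumBelow n h +_) (missing-∈ 1+n∈) ⟩
    sumBelow n h + 0        ≡⟨ +-identityʳ _ ⟩
    sumBelow n h            ∎

∈-missingParts⁺ : 0 < x → x ≤ n → x ∉ ys → x ∈ missingParts n ys
∈-missingParts⁺ 0<x x≤n x∉ = ∈-filter⁺ (λ μ → ¬? (μ ∈? _)) (∈-oneTo⁺ 0<x x≤n) x∉

∈-missingParts⁻ : x ∈ missingParts n ys → x ∉ ys
∈-missingParts⁻ {n = n} x∈ = proj₂ (∈-filter⁻ (λ μ → ¬? (μ ∈? _)) {xs = oneTo n} x∈)

refinable-pair : x ≢ y → x ∈ missingParts n ys → y ∈ missingParts n ys → x + y ∈ ys → Refinable n ys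
refinable-pair {x} {y} x≢y x∈M y∈M x+y∈ =
  x + y , x+y∈ , x ∷ y ∷ [] , (x≢y ∷ []) ∷ [] ∷ [] , ≤-refl , x∈M ∷ y∈M ∷ [] ,
  cong (x +_) (+-identityʳ y)

module FromUnrefinable (m : ℕ) (3∤p : 3 ∤ suc (m + m)) {G : List ℕ}
  (dp : IsDistinctPartition G) (largest : LargestPart G (suc (m + m)))
  (unrefinable : ¬ Refinable (suc (m + m)) G)
  (count : length (missingParts (suc (m + m)) G) ≡ suc (m + m) / 2) where

  private
    p : ℕ
    p = suc (m + m)

  open IsDistinctPartition dp

  G-increasing : StrictlyIncreasing G
  G-increasing = Linked.Linked⇒AllPairs <-trans increasing

  p∈G : p ∈ G
  p∈G = last-∈ largest

  bounded : x ∈ G → 0 < x × x ≤ p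
  bounded x∈ = All.lookup positive x∈ , All.lookup (last-maximum G-increasing largest) x∈

  0∉G : 0 ∉ G
  0∉G 0∈ = contradiction (All.lookup positive 0∈) λ ()

  G⊆oneTo : G ⊆ oneTo p
  G⊆oneTo = increasing-⊆ G-increasing (oneTo-increasing p) (uncurry ∈-oneTo⁺ ∘ bounded)

  sum∉-distinct : x ≢ y → 0 < x → 0 < y → x ∉ G → y ∉ G → x + y ∉ G
  sum∉-distinct {x} x≢y 0<x 0<y x∉ y∉ x+y∈ = unrefinable (refinable-pair x≢y
    (∈-missingParts⁺ 0<x (m+n≤o⇒m≤o x x+y≤p) x∉)
    (∈-missingParts⁺ 0<y (m+n≤o⇒n≤o x x+y≤p) y∉)
    x+y∈)
    where x+y≤p = proj₂ (bounded x+y∈)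

  not-both-missing : 0 < x → x < p → ¬ (x ∉ G × p ∸ x ∉ G)
  not-both-missing {x} 0<x x<p (x∉ , p∸x∉) =
    sum∉-distinct x≢p∸x 0<x (m<n⇒0<n∸m x<p) x∉ p∸x∉ (subst (_∈ G) (sym x+[p∸x]≡p) p∈G)
    where
    x+[p∸x]≡p = m+[n∸m]≡n (<⇒≤ x<p)
    x≢p∸x : x ≢ p ∸ x
    x≢p∸x eq = x+x≢1+m+m x m (trans (cong (x +_) eq) x+[p∸x]≡p)

  complement∈ : 0 < x → x < p → x ∉ G → p ∸ x ∈ G
  complement∈ {x} 0<x x<p x∉ with (p ∸ x) ∈? G
  ... | yes p∸x∈ = p∸x∈
  ... | no  p∸x∉ = contradiction (x∉ , p∸x∉) (not-both-missing 0<x x<p)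

  exactly-one-missing : ∀ {i} → i < m + m → missing G (suc i) + missing G (p ∸ suc i) ≡ 1
  exactly-one-missing =
    sumBelow≡n⇒ones (λ i<2m → missing+missing≤1 (not-both-missing z<s (s<s i<2m))) pairs≡2m
    where
    count≡m = trans count (1+m+m/2≡m m)
    pairs≡2m : sumBelow (m + m) (λ i → missing G (suc i) + missing G (p ∸ suc i)) ≡ m + m
    pairs≡2m = trans (sym (missingParts-double (m + m) G p∈G)) (cong₂ _+_ count≡m count≡m)

  symmetric : x ∈ G → p ∸ x ∉ G
  symmetric {zero}  0∈ = contradiction 0∈ 0∉G
  symmetric {suc i} x∈ with m≤n⇒m<n∨m≡n (proj₂ (bounded x∈))
  ... | inj₁ (s<s i<2m) = missing+missing≡1⇒ (exactly-one-missing i<2m) x∈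
  ... | inj₂ refl       = subst (_∉ G) (sym (n∸n≡0 p)) 0∉G

  double∉ : ∀ {a} → 0 < a → a ∉ G → a + a ≤ p → a + a ∉ G
  double∉ {a} 0<a a∉ 2a≤p 2a∈ =
    sum∉-distinct a≢r 0<a (m<n⇒0<n∸m 2a<p) a∉ (symmetric 2a∈)
      (subst (_∈ G) p∸a≡a+r (complement∈ 0<a a<p a∉))
    where
    open ≡-Reasoning
    2a<p = ≤∧≢⇒< 2a≤p (x+x≢1+m+m a m)
    a<p  = ≤-<-trans (m≤m+n a a) 2a<p
    r = p ∸ (a + a)
    2a+r≡p = m+[n∸m]≡n 2a≤p
    p∸a≡a+r : p ∸ a ≡ a + r
    p∸a≡a+r = begin
      p ∸ a            ≡⟨ cong (_∸ a) (sym 2a+r≡p) ⟩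
      a + a + r ∸ a    ≡⟨ cong (_∸ a) (+-assoc a a r) ⟩
      a + (a + r) ∸ a  ≡⟨ m+n∸m≡n a (a + r) ⟩
      a + r            ∎
    a≢r : a ≢ r
    a≢r a≡r = 3∤p (divides a (begin
      p          ≡⟨ sym 2a+r≡p ⟩
      a + a + r  ≡⟨ cong (a + a +_) (sym a≡r) ⟩
      a + a + a  ≡⟨ x+x+x≡x*3 a ⟩
      a * 3      ∎))

  sum∉ : ∀ a b → a ∉ G → b ∉ G → a + b ≤ p → a + b ∉ G
  sum∉ zero    b       _  b∉ _     = b∉
  sum∉ (suc a) zero    a∉ _  _     = subst (_∉ G) (sym (+-identityʳ (suc a))) a∉
  sum∉ (suc a) (suc b) a∉ b∉ a+b≤p with suc a ≟ suc b
  ... | no  a≢b = sum∉-distinct a≢b z<s z<s a∉ b∉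
  ... | yes refl = double∉ z<s a∉ a+b≤p

  gapSet : IsSymmetricGapSet p G
  gapSet = record { frobenius∈ = p∈G ; sum∉ = sum∉ ; symmetric = symmetric }

module FromGapSet (m : ℕ) (0<m : 0 < m) {G : List ℕ}
  (G⊆oneTo : G ⊆ oneTo (suc (m + m))) (gs : IsSymmetricGapSet (suc (m + m)) G) where

  private
    p : ℕ
    p = suc (m + m)

  open IsSymmetricGapSet gs

  G-increasing : StrictlyIncreasing G
  G-increasing = AllPairs-resp-⊆ G⊆oneTo (oneTo-increasing p)

  bounded : x ∈ G → 0 < x × x ≤ p
  bounded = ∈-oneTo⁻ ∘ lookup G⊆oneTo

  twoParts : 2 ≤ length G
  twoParts with 1 ∈? G
  ... | yes 1∈ = ∈-∈-≢⇒2≤length 1∈ frobenius∈ (<⇒≢ (s<s (≤-trans 0<m (m≤m+n m m))))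
  ... | no  1∉ = ∈-∈-≢⇒2≤length (complement∈ (s≤s z≤n) 1∉) frobenius∈ (<⇒≢ (n<1+n (m + m)))

  distinctPartition : IsDistinctPartition G
  distinctPartition = record
    { increasing = Linked.AllPairs⇒Linked G-increasing
    ; positive   = All.tabulate (proj₁ ∘ bounded)
    ; twoParts   = twoParts
    }

  largest : LargestPart G p
  largest = maximum-last G-increasing (All.tabulate (proj₂ ∘ bounded)) frobenius∈

  unrefinable : ¬ Refinable p G
  unrefinable (ℓ , ℓ∈ , μs , _ , _ , μs∈M , Σμs≡ℓ) =
    sum-∉ (All.map ∈-missingParts⁻ μs∈M) (subst (_≤ p) (sym Σμs≡ℓ) (proj₂ (bounded ℓ∈)))
      (subst (_∈ G) (sym Σμs≡ℓ) ℓ∈)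

  missingCount : length (missingParts p G) ≡ p / 2
  missingCount = trans (sym (1+m+m/2≡m M)) (cong (λ k → suc k / 2) M+M≡m+m)
    where
    M = length (missingParts p G)
    exactly-one-missing : ∀ {i} → i < m + m → missing G (suc i) + missing G (p ∸ suc i) ≡ 1
    exactly-one-missing i<2m = missing+missing≡1 symmetric (complement∈ (s≤s (<⇒≤ i<2m)))
    M+M≡m+m : M + M ≡ m + m
    M+M≡m+m = trans (missingParts-double (m + m) G frobenius∈) (sumBelow-ones exactly-one-missing)

  inUbar : InUbar p G
  inUbar = distinctPartition , largest , unrefinable , missingCount

-- Symmetric numerical semigroups and symmetric gap sets

fromGaps : List ℕ → Subset
fromGaps G x = not (does (x ∈? G))

fromGaps-∈ : x ∈ G → fromGaps G x ≡ false
fromGaps-∈ {x} {G} x∈ with x ∈? G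
... | yes _  = refl
... | no x∉ = contradiction x∈ x∉

fromGaps-∉ : x ∉ G → fromGaps G x ≡ true
fromGaps-∉ {x} {G} x∉ with x ∈? G
... | yes x∈ = contradiction x∈ x∉
... | no _   = refl

fromGaps≡false⇒∈ : fromGaps G x ≡ false → x ∈ G
fromGaps≡false⇒∈ {G} {x} eq with x ∈? G
... | yes x∈ = x∈
... | no _   = contradiction eq λ ()

fromGaps-injective : StrictlyIncreasing G → StrictlyIncreasing H → fromGaps G ≐ fromGaps H → G ≡ H
fromGaps-injective iG iH G≐H = increasing-≡ iG iH
  (λ {z} z∈G → fromGaps≡false⇒∈ (trans (sym (G≐H z)) (fromGaps-∈ z∈G)))
  (λ {z} z∈H → fromGaps≡false⇒∈ (trans (G≐H z) (fromGaps-∈ z∈H)))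

fromGaps-distinct : ∀ {Gs} → Unique Gs → All StrictlyIncreasing Gs →
  AllPairs (λ S T → ¬ (S ≐ T)) (map fromGaps Gs)
fromGaps-distinct []           []         = []
fromGaps-distinct (G≢Gs ∷ uGs) (iG ∷ iGs) =
  All.map⁺ (All.zipWith (λ (G≢H , iH) G≐H → G≢H (fromGaps-injective iG iH G≐H)) (G≢Gs , iGs))
  ∷ fromGaps-distinct uGs iGs

fromGaps-symmetric : ∀ {p} → p % 2 ≡ 1 → G ⊆ oneTo p → IsSymmetricGapSet p G →
  SymmetricWithFrobenius p (fromGaps G)
fromGaps-symmetric {G = G} {p = p} odd G⊆oneTo gs =
  semigroup , (fromGaps-∈ frobenius∈ , λ _ → fromGaps-∉ ∘ >p∉) , odd ,
  λ _ x-gap → fromGaps-∉ (symmetric (fromGaps≡false⇒∈ x-gap))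
  where
  open IsSymmetricGapSet gs
  >p∉ : p < x → x ∉ G
  >p∉ p<x x∈ = <⇒≱ p<x (proj₂ (∈-oneTo⁻ (lookup G⊆oneTo x∈)))
  ∉-fromGaps : fromGaps G x ≡ true → x ∉ G
  ∉-fromGaps eq x∈ = Bool.not-¬ eq (fromGaps-∈ x∈)
  closed : ∀ a b → fromGaps G a ≡ true → fromGaps G b ≡ true → fromGaps G (a + b) ≡ true
  closed a b a∈S b∈S with a + b ≤? p
  ... | yes a+b≤p = fromGaps-∉ (sum∉ a b (∉-fromGaps a∈S) (∉-fromGaps b∈S) a+b≤p)
  ... | no  a+b≰p = fromGaps-∉ (>p∉ (≰⇒> a+b≰p))
  semigroup : IsNumericalSemigroup (fromGaps G)
  semigroup = record
    { zero∈ = fromGaps-∉ 0∉ ; closed = closed ; cofinite = suc p , λ _ → fromGaps-∉ ∘ >p∉ }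

gapsOf : ℕ → Subset → List ℕ
gapsOf p S = filter (λ x → S x Bool.≟ false) (oneTo p)

∈-gapsOf⁻ : ∀ p S → x ∈ gapsOf p S → S x ≡ false
∈-gapsOf⁻ p S x∈ = proj₂ (∈-filter⁻ (λ x → S x Bool.≟ false) {xs = oneTo p} x∈)

module _ {p : ℕ} (semigroup : IsNumericalSemigroup S) (frobenius : HasFrobenius S p) where

  open IsNumericalSemigroup semigroup

  ∈-gapsOf⁺ : S x ≡ false → x ∈ gapsOf p S
  ∈-gapsOf⁺ {zero}  gap = contradiction zero∈ (Bool.not-¬ gap)
  ∈-gapsOf⁺ {suc x} gap with suc x ≤? p
  ... | yes x≤p = ∈-filter⁺ (λ x → S x Bool.≟ false) (∈-oneTo⁺ z<s x≤p) gap
  ... | no  x≰p = contradiction (proj₂ frobenius (suc x) (≰⇒> x≰p)) (Bool.not-¬ gap)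

  ∉-gapsOf : x ∉ gapsOf p S → S x ≡ true
  ∉-gapsOf x∉ = Bool.¬-not (x∉ ∘ ∈-gapsOf⁺)

  ≐fromGaps-gapsOf : S ≐ fromGaps (gapsOf p S)
  ≐fromGaps-gapsOf x with x ∈? gapsOf p S
  ... | yes x∈ = ∈-gapsOf⁻ p S x∈
  ... | no  x∉ = ∉-gapsOf x∉

  gapsOf-symmetric : (∀ x → S x ≡ false → S (p ∸ x) ≡ true) → IsSymmetricGapSet p (gapsOf p S)
  gapsOf-symmetric S-sym = record
    { frobenius∈ = ∈-gapsOf⁺ (proj₁ frobenius)
    ; sum∉       = λ a b a∉ b∉ _ a+b∈ →
        Bool.not-¬ (closed a b (∉-gapsOf a∉) (∉-gapsOf b∉)) (∈-gapsOf⁻ p S a+b∈)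
    ; symmetric  = λ {x} x∈ p∸x∈ →
        Bool.not-¬ (S-sym x (∈-gapsOf⁻ p S x∈)) (∈-gapsOf⁻ p S p∸x∈)
    }

symmetricWithFrobenius-resp-≐ : ∀ {p} → S ≐ T → SymmetricWithFrobenius p T → SymmetricWithFrobenius p S
symmetricWithFrobenius-resp-≐ {S} {T} S≐T (semigroup , (p-gap , >p∈) , odd , T-sym) =
  semigroupS , (trans (S≐T _) p-gap , λ x p<x → trans (S≐T x) (>p∈ x p<x)) , odd ,
  λ x x-gap → trans (S≐T _) (T-sym x (trans (sym (S≐T x)) x-gap))
  where
  open IsNumericalSemigroup semigroup
  semigroupS : IsNumericalSemigroup S
  semigroupS = record
    { zero∈    = trans (S≐T 0) zero∈
    ; closed   = λ a b a∈ b∈ →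
        trans (S≐T (a + b)) (closed a b (trans (sym (S≐T a)) a∈) (trans (sym (S≐T b)) b∈))
    ; cofinite = proj₁ cofinite , λ x N≤x → trans (S≐T x) (proj₂ cofinite x N≤x)
    }

unrefinableCount : ∀ m → 0 < m → 3 ∤ suc (m + m) →
  HasCount (InUbar (suc (m + m))) (length (gapSets (suc (m + m))))
unrefinableCount m 0<m 3∤p = gapSets p , refl , gapSets-unique p , λ G → mk⇔ to from
  where
  p = suc (m + m)
  to : ∀ {G} → G ∈ gapSets p → InUbar p G
  to G∈ = let G⊆oneTo , gs = ∈-gapSets⁻ G∈ in FromGapSet.inUbar m 0<m G⊆oneTo gs
  from : ∀ {G} → InUbar p G → G ∈ gapSets p
  from (dp , largest , unrefinable , count) = ∈-gapSets⁺ G⊆oneTo gapSet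
    where open FromUnrefinable m 3∤p dp largest unrefinable count

symmetricCount : ∀ p → p % 2 ≡ 1 → HasCountSubsets (SymmetricWithFrobenius p) (length (gapSets p))
symmetricCount p odd = map fromGaps (gapSets p) , length-map fromGaps (gapSets p) ,
  fromGaps-distinct (gapSets-unique p) (gapSets-increasing p) , λ S → mk⇔ to from
  where
  to : Any (S ≐_) (map fromGaps (gapSets p)) → SymmetricWithFrobenius p S
  to S∈ with find (Any.map⁻ S∈)
  ... | G , G∈ , S≐G = let G⊆oneTo , gs = ∈-gapSets⁻ G∈ in
    symmetricWithFrobenius-resp-≐ S≐G (fromGaps-symmetric odd G⊆oneTo gs)
  from : SymmetricWithFrobenius p S → Any (S ≐_) (map fromGaps (gapSets p))
  from (semigroup , frobenius , _ , S-sym) =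
    lose (∈-map⁺ fromGaps (∈-gapSets⁺ (filter-⊆ _ _) (gapsOf-symmetric semigroup frobenius S-sym)))
         (≐fromGaps-gapsOf semigroup frobenius)

mainTheorem1 : (p : ℕ) → Prime p → 3 < p →
    ∃[ k ] (HasCount (InUbar p) k × HasCountSubsets (SymmetricWithFrobenius p) k)
mainTheorem1 p p-prime 3<p with prime-odd p-prime (<-trans (n<1+n 2) 3<p)
... | m , refl = length (gapSets p) , unrefinableCount m 0<m 3∤p , symmetricCount p (1+m+m%2≡1 m)
  where
  0<m : 0 < m
  0<m = n≢0⇒n>0 λ { refl → contradiction 3<p λ { (s≤s ()) } }
  3∤p : 3 ∤ p
  3∤p 3∣p with prime⇒irreducible p-prime 3∣p
  ... | inj₁ ()
  ... | inj₂ 3≡p = <⇒≢ 3<p 3≡p
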